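{- Let $\alpha=(\alpha_1,\dots,\alpha_m)$ be a partition of $n$ and let $r\in\mathbb{N}$. Then there is an isomorphism (natural isomorphism) of species $$\mathbf{C}_\alpha\circ X^r=\mathbf{C}_{\alpha^r},$$ where $\alpha^r=(\alpha_1,\dots,\alpha_1,\alpha_2,\dots,\alpha_2,\dots,\alpha_m,\dots,\alpha_m)$ is the partition of $nr$ containing exactly $r$ copies of each part $\alpha_i$.
   Context: A species is a functor from finite sets with bijections to finite sets. For $H\le S_n$, $X^n/H$ is the species with $(X^n/H)[U]=\{\lambda H:\lambda:[n]\to U\text{ bijection}\}$ and $(X^n/H)[f](\lambda H)=(f\lambda)H$. For a partition $\alpha$ of $n$, the standard permutation $\sigma_\alpha\in S_n$ is the product of disjoint cycles $(1,\dots,\alpha_1)(\alpha_1+1,\dots,\alpha_1+\alpha_2)\cdots$ (cycles of lengths $\alpha_1,\alpha_2,\dots$ filled with $1,\dots,n$ in increasing order), and $\mathbf{C}_\alpha:=X^n/\langle\sigma_\alpha\rangle$. $X^r$ is the species of linear orders (lists) of length $r$ on sets of size $r$ (empty otherwise), and $\circ$ denotes composition (substitution) of species: an $(F\circ G)$-structure on $U$ consists of a partition $\pi$ of $U$, a $G$-structure on each block of $\pi$, and an $F$-structure on the set of blocks. -}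

module Defs where

open import Level using (0ℓ)
open import Data.Nat using (ℕ; zero; suc; _+_; _≤_; _≥_; NonZero)
open import Data.Nat.DivMod using (_%_; m%n<n)
open import Data.Fin as Fin using (Fin; zero; suc; toℕ; fromℕ<; splitAt; join)
open import Data.Sum using (_⊎_; inj₁; inj₂)
open import Data.Product using (Σ; ∃; _×_; _,_; proj₁; proj₂)
open import Data.Product.Properties using (≡-dec)
open import Data.List using (List; []; _∷_; concatMap; replicate)
open import Data.Nat.ListAction using (sum)
open import Data.List.Membership.Propositional using (_∈_)
open import Data.List.Relation.Unary.Any using (here; there)
open import Data.List.Relation.Unary.All using (All)
open import Data.List.Relation.Unary.Linked using (Linked)
open import Function using (_∘_; id)
open import Function.Bundles using (Inverse; _↔_; mk↔ₛ′)
open import Function.Construct.Composition using (_↔-∘_)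
open import Relation.Nullary using (yes; no)
open import Relation.Binary using (Setoid; Rel; DecidableEquality)
open import Relation.Binary.PropositionalEquality
  using (_≡_; refl; sym; trans; cong)
import Relation.Binary.Construct.Closure.Equivalence as EqC
open import Axiom.UniquenessOfIdentityProofs using (module Decidable⇒UIP)

record FinSet : Set₁ where
  field
    Carrier  : Set
    _≟_      : DecidableEquality Carrier
    elems    : List Carrier
    complete : ∀ x → x ∈ elems

open FinSet public using (Carrier)

allFinL : ∀ k → List (Fin k)
allFinL zero    = []
allFinL (suc k) = zero ∷ Data.List.map suc (allFinL k)

allFinL-complete : ∀ {k} (x : Fin k) → x ∈ allFinL k
allFinL-complete zero    = here refl
allFinL-complete (suc x) = there (mapSuc (allFinL-complete x))
  where
  mapSuc : ∀ {k} {y : Fin k} {ys} → y ∈ ys → suc y ∈ Data.List.map suc ys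
  mapSuc (here p)  = here (cong suc p)
  mapSuc (there p) = there (mapSuc p)

FinFS : ℕ → FinSet
FinFS k = record { Carrier = Fin k ; _≟_ = Fin._≟_ ; elems = allFinL k
                 ; complete = allFinL-complete }

Fib : (U : FinSet) {k : ℕ} (blk : Carrier U → Fin k) (i : Fin k) → Set
Fib U blk i = Σ (Carrier U) (λ u → blk u ≡ i)

Fin-irr : ∀ {k} {i j : Fin k} (p q : i ≡ j) → p ≡ q
Fin-irr = Decidable⇒UIP.≡-irrelevant Fin._≟_

Σ-ext : ∀ {A : Set} {k} {f : A → Fin k} {i} {u v : A} {p : f u ≡ i} {q : f v ≡ i}
        → u ≡ v → _≡_ {A = Σ A (λ a → f a ≡ i)} (u , p) (v , q)
Σ-ext {p = p} {q} refl = cong (_ ,_) (Fin-irr p q)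

fibList : {A : Set} {k : ℕ} (blk : A → Fin k) (i : Fin k) → List A
          → List (Σ A (λ u → blk u ≡ i))
fibList blk i []       = []
fibList blk i (u ∷ us) with blk u Fin.≟ i
... | yes p = (u , p) ∷ fibList blk i us
... | no _  = fibList blk i us

fibList-complete : {A : Set} {k : ℕ} (blk : A → Fin k) (i : Fin k) {us : List A}
                   (x : Σ A (λ u → blk u ≡ i)) → proj₁ x ∈ us → x ∈ fibList blk i us
fibList-complete blk i {u ∷ us} x (here e) with blk u Fin.≟ i
... | yes p = here (Σ-ext e)
... | no ¬p = Data.Empty.⊥-elim (¬p (trans (cong blk (sym e)) (proj₂ x)))
  where import Data.Empty
fibList-complete blk i {u ∷ us} x (there m) with blk u Fin.≟ i
... | yes p = there (fibList-complete blk i x m)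
... | no _  = fibList-complete blk i x m

FibFS : (U : FinSet) {k : ℕ} (blk : Carrier U → Fin k) (i : Fin k) → FinSet
FibFS U blk i = record
  { Carrier  = Fib U blk i
  ; _≟_      = ≡-dec (FinSet._≟_ U) (λ p q → yes (Fin-irr p q))
  ; elems    = fibList blk i (FinSet.elems U)
  ; complete = λ x → fibList-complete blk i x (FinSet.complete U (proj₁ x))
  }

restrict : (U V : FinSet) {k k' : ℕ} (g : Carrier U ↔ Carrier V)
           (blk : Carrier U → Fin k) (blk' : Carrier V → Fin k')
           (σ : Fin k ↔ Fin k')
           (eq : ∀ u → blk' (Inverse.to g u) ≡ Inverse.to σ (blk u))
           (i : Fin k) → Fib U blk i ↔ Fib V blk' (Inverse.to σ i)
restrict U V g blk blk' σ eq i = mk↔ₛ′ to from invˡ invʳ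
  where
  module g = Inverse g
  module σ = Inverse σ
  to : Fib U blk i → Fib V blk' (σ.to i)
  to (u , p) = g.to u , trans (eq u) (cong σ.to p)
  from : Fib V blk' (σ.to i) → Fib U blk i
  from (v , q) = g.from v ,
    trans (sym (σ.strictlyInverseʳ (blk (g.from v))))
      (trans (cong σ.from (sym (eq (g.from v))))
        (trans (cong (σ.from ∘ blk') (g.strictlyInverseˡ v))
          (trans (cong σ.from q) (σ.strictlyInverseʳ i))))
  invˡ : ∀ y → to (from y) ≡ y
  invˡ (v , q) = Σ-ext (g.strictlyInverseˡ v)
  invʳ : ∀ x → from (to x) ≡ x
  invʳ (u , p) = Σ-ext (g.strictlyInverseʳ u)

-- Species: for each finite set U a setoid of structures F[U] (a set,
-- possibly presented as a quotient), and transport along bijections.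

record Species : Set₂ where
  field
    Str : FinSet → Setoid 0ℓ 0ℓ
    map : {U V : FinSet} → Carrier U ↔ Carrier V
          → Setoid.Carrier (Str U) → Setoid.Carrier (Str V)

open Species public

record _≅_ (F G : Species) : Set₁ where
  field
    iso     : (U : FinSet) → Inverse (Str F U) (Str G U)
    natural : {U V : FinSet} (f : Carrier U ↔ Carrier V)
              (x : Setoid.Carrier (Str F U)) →
              Setoid._≈_ (Str G V) (Inverse.to (iso V) (map F f x))
                                   (map G f (Inverse.to (iso U) x))

-- Structures on U: bijections λ : [n] → U, up to λ ~ λ h (h ∈ H); the
-- setoid of cosets is the quotient by (the equivalence relation generated
-- by) this relation.

cosetRel : (n : ℕ) (H : (Fin n ↔ Fin n) → Set) (U : FinSet)
           → Rel (Fin n ↔ Carrier U) 0ℓ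
cosetRel n H U λ₁ μ = Σ (Fin n ↔ Fin n) (λ h →
  H h × (∀ x → Inverse.to μ x ≡ Inverse.to λ₁ (Inverse.to h x)))

XnMod : (n : ℕ) (H : (Fin n ↔ Fin n) → Set) → Species
XnMod n H = record
  { Str = λ U → EqC.setoid (cosetRel n H U)
  ; map = λ f λ₁ → f ↔-∘ λ₁
  }

-- X^r: linear orders = bijections [r] → U (equal when pointwise equal)
listSetoid : (r : ℕ) (U : FinSet) → Setoid 0ℓ 0ℓ
listSetoid r U = record
  { Carrier = Fin r ↔ Carrier U
  ; _≈_ = λ λ₁ μ → ∀ x → Inverse.to λ₁ x ≡ Inverse.to μ x
  ; isEquivalence = record
    { refl = λ x → refl
    ; sym = λ p x → sym (p x)
    ; trans = λ p q x → trans (p x) (q x) }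
  }

Xpow : ℕ → Species
Xpow r = record { Str = listSetoid r ; map = λ f λ₁ → f ↔-∘ λ₁ }

-- A structure on U: a partition of U into k
-- nonempty blocks, presented by a surjective labelling blk : U → [k],
-- a G-structure on each block, and an F-structure on the set of blocks;
-- two presentations are identified when they differ by a relabelling
-- σ of the blocks (transporting all structures along σ).

record CompStr (F G : Species) (U : FinSet) : Set where
  field
    k        : ℕ
    blk      : Carrier U → Fin k
    nonempty : ∀ i → ∃ λ u → blk u ≡ i
    gstr     : (i : Fin k) → Setoid.Carrier (Str G (FibFS U blk i))
    fstr     : Setoid.Carrier (Str F (FinFS k))

idU : (U : FinSet) → Carrier U ↔ Carrier U
idU U = mk↔ₛ′ id id (λ _ → refl) (λ _ → refl)

relabel : (F G : Species) (U : FinSet) → Rel (CompStr F G U) 0ℓ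
relabel F G U s t =
  Σ (Fin (CompStr.k s) ↔ Fin (CompStr.k t)) λ σ →
  Σ (∀ u → CompStr.blk t u ≡ Inverse.to σ (CompStr.blk s u)) λ eq →
    Setoid._≈_ (Str F (FinFS (CompStr.k t)))
      (map F {FinFS (CompStr.k s)} {FinFS (CompStr.k t)} σ (CompStr.fstr s))
      (CompStr.fstr t)
  × (∀ i → Setoid._≈_ (Str G (FibFS U (CompStr.blk t) (Inverse.to σ i)))
        (map G {FibFS U (CompStr.blk s) i} {FibFS U (CompStr.blk t) (Inverse.to σ i)}
           (restrict U U (idU U) (CompStr.blk s) (CompStr.blk t) σ eq i)
           (CompStr.gstr s i))
        (CompStr.gstr t (Inverse.to σ i)))

compMap : (F G : Species) {U V : FinSet} → Carrier U ↔ Carrier V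
          → CompStr F G U → CompStr F G V
compMap F G {U} {V} f s = record
  { k        = k
  ; blk      = blk ∘ f.from
  ; nonempty = λ i → f.to (proj₁ (nonempty i)) ,
                 trans (cong blk (f.strictlyInverseʳ (proj₁ (nonempty i))))
                       (proj₂ (nonempty i))
  ; gstr     = λ i → map G {FibFS U blk i} {FibFS V (blk ∘ f.from) i}
                 (restrict U V f blk (blk ∘ f.from) (idU (FinFS k) )
                    (λ u → cong blk (f.strictlyInverseʳ u)) i) (gstr i)
  ; fstr     = fstr
  }
  where
  open CompStr s
  module f = Inverse f

_∘S_ : Species → Species → Species
F ∘S G = record
  { Str = λ U → EqC.setoid (relabel F G U)
  ; map = compMap F G
  }

IsPartition : List ℕ → Set
IsPartition α = All (λ a → 1 ≤ a) α × Linked _≥_ α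

cyc : ∀ {a} → Fin a → Fin a
cyc {suc a} x = fromℕ< (m%n<n (suc (toℕ x)) (suc a))

stdPerm : (α : List ℕ) → Fin (sum α) → Fin (sum α)
stdPerm []       x = x
stdPerm (a ∷ as) x with splitAt a x
... | inj₁ y = join a (sum as) (inj₁ (cyc y))
... | inj₂ z = join a (sum as) (inj₂ (stdPerm as z))

iter : ∀ {A : Set} → ℕ → (A → A) → A → A
iter zero    f x = x
iter (suc j) f x = f (iter j f x)

cyclicSub : ∀ {n} (σ : Fin n → Fin n) → (Fin n ↔ Fin n) → Set
cyclicSub σ h = ∃ λ j → ∀ x → Inverse.to h x ≡ iter j σ x

C : (α : List ℕ) → Species
C α = XnMod (sum α) (cyclicSub (stdPerm α))

_^P_ : List ℕ → ℕ → List ℕ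
α ^P r = concatMap (replicate r) α

module Submission where

-- Sending the x-th point of the p-th copy of the part α_k of α^r to
-- (x-th point of the part α_k of α , p) is a bijection [nr] ≅ [n] × [r]
-- conjugating σ_{α^r} to σ_α × id.  So a list λ : [nr] → U modulo ⟨σ_{α^r}⟩
-- is the same as the partition of U into the n blocks λ({i} × [r]), each
-- ordered by p, together with the blocks listed modulo ⟨σ_α⟩.

open import Defs
open import Data.Nat using (ℕ; zero; suc; _≤_)
open import Data.Fin using (Fin; zero; suc; splitAt; join)
open import Data.Fin.Properties using (splitAt-join; join-splitAt)
open import Data.Sum as Sum using (inj₁; inj₂)
open import Data.Product using (_×_; _,_; proj₁; proj₂; map₁)
open import Data.List using (List; []; _∷_; _++_; replicate)
open import Data.Nat.ListAction using (sum)
open import Relation.Binary.PropositionalEquality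
open import Function using (id; _∘_)
open import Function.Bundles using (Inverse; _↔_; mk↔ₛ′)
open import Function.Construct.Composition using (_↔-∘_)
import Relation.Binary.Construct.Closure.Equivalence as EqC

record Conjugate {A B : Set} (f : A → A) (g : B → B) : Set where
  field
    to               : A → B
    from             : B → A
    strictlyInverseˡ : ∀ b → to (from b) ≡ b
    strictlyInverseʳ : ∀ a → from (to a) ≡ a
    commute          : ∀ a → to (f a) ≡ g (to a)

Conjugate-refl : ∀ {A : Set} {f : A → A} → Conjugate f f
Conjugate-refl = record
  { to = id ; from = id ; strictlyInverseˡ = λ _ → refl ; strictlyInverseʳ = λ _ → refl
  ; commute = λ _ → refl }

Conjugate-sym : ∀ {A B : Set} {f : A → A} {g : B → B} → Conjugate f g → Conjugate g f
Conjugate-sym {f = f} {g} c = record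
  { to = c.from ; from = c.to
  ; strictlyInverseˡ = c.strictlyInverseʳ ; strictlyInverseʳ = c.strictlyInverseˡ
  ; commute = λ b → begin
      c.from (g b)                 ≡⟨ cong (c.from ∘ g) (sym (c.strictlyInverseˡ b)) ⟩
      c.from (g (c.to (c.from b))) ≡⟨ cong c.from (sym (c.commute (c.from b))) ⟩
      c.from (c.to (f (c.from b))) ≡⟨ c.strictlyInverseʳ _ ⟩
      f (c.from b)                 ∎ }
  where module c = Conjugate c; open ≡-Reasoning

Conjugate-trans : ∀ {A B D : Set} {f : A → A} {g : B → B} {h : D → D}
                  → Conjugate f g → Conjugate g h → Conjugate f h
Conjugate-trans c d = record
  { to = d.to ∘ c.to ; from = c.from ∘ d.from
  ; strictlyInverseˡ = λ b → trans (cong d.to (c.strictlyInverseˡ _)) (d.strictlyInverseˡ b)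
  ; strictlyInverseʳ = λ a → trans (cong c.from (d.strictlyInverseʳ _)) (c.strictlyInverseʳ a)
  ; commute = λ a → trans (cong d.to (c.commute a)) (d.commute _) }
  where module c = Conjugate c; module d = Conjugate d

Conjugate-⊎ : ∀ {A B A′ B′ : Set} {f : A → A} {g : B → B} {f′ : A′ → A′} {g′ : B′ → B′}
              → Conjugate f g → Conjugate f′ g′ → Conjugate (Sum.map f f′) (Sum.map g g′)
Conjugate-⊎ c d = record
  { to = Sum.map c.to d.to ; from = Sum.map c.from d.from
  ; strictlyInverseˡ = λ { (inj₁ b) → cong inj₁ (c.strictlyInverseˡ b)
                         ; (inj₂ b) → cong inj₂ (d.strictlyInverseˡ b) }
  ; strictlyInverseʳ = λ { (inj₁ a) → cong inj₁ (c.strictlyInverseʳ a)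
                         ; (inj₂ a) → cong inj₂ (d.strictlyInverseʳ a) }
  ; commute = λ { (inj₁ a) → cong inj₁ (c.commute a) ; (inj₂ a) → cong inj₂ (d.commute a) } }
  where module c = Conjugate c; module d = Conjugate d

Conjugate-map₁ : ∀ {A B R : Set} {f : A → A} {g : B → B}
                 → Conjugate f g → Conjugate (map₁ {C = R} f) (map₁ g)
Conjugate-map₁ c = record
  { to = map₁ c.to ; from = map₁ c.from
  ; strictlyInverseˡ = λ { (b , x) → cong (_, x) (c.strictlyInverseˡ b) }
  ; strictlyInverseʳ = λ { (a , x) → cong (_, x) (c.strictlyInverseʳ a) }
  ; commute = λ { (a , x) → cong (_, x) (c.commute a) } }
  where module c = Conjugate c

⊎-assoc-Conjugate : ∀ {A B D : Set} {f : A → A} {g : B → B} {h : D → D}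
  → Conjugate (Sum.map f (Sum.map g h)) (Sum.map (Sum.map f g) h)
⊎-assoc-Conjugate = record
  { to = Sum.assocˡ ; from = Sum.assocʳ
  ; strictlyInverseˡ = λ { (inj₁ (inj₁ a)) → refl ; (inj₁ (inj₂ b)) → refl ; (inj₂ d) → refl }
  ; strictlyInverseʳ = λ { (inj₁ a) → refl ; (inj₂ (inj₁ b)) → refl ; (inj₂ (inj₂ d)) → refl }
  ; commute = λ { (inj₁ a) → refl ; (inj₂ (inj₁ b)) → refl ; (inj₂ (inj₂ d)) → refl } }

⊎-identityˡ-Conjugate : ∀ {B : Set} {g : B → B} → Conjugate g (Sum.map (id {A = Fin 0}) g)
⊎-identityˡ-Conjugate = record
  { to = inj₂ ; from = λ { (inj₂ b) → b }
  ; strictlyInverseˡ = λ { (inj₂ b) → refl } ; strictlyInverseʳ = λ _ → refl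
  ; commute = λ _ → refl }

×-distribʳ-⊎-Conjugate : ∀ {A B R : Set} {f : A → A} {g : B → B}
  → Conjugate (Sum.map (map₁ {C = R} f) (map₁ g)) (map₁ (Sum.map f g))
×-distribʳ-⊎-Conjugate = record
  { to = λ { (inj₁ (a , x)) → inj₁ a , x ; (inj₂ (b , x)) → inj₂ b , x }
  ; from = λ { (inj₁ a , x) → inj₁ (a , x) ; (inj₂ b , x) → inj₂ (b , x) }
  ; strictlyInverseˡ = λ { (inj₁ a , x) → refl ; (inj₂ b , x) → refl }
  ; strictlyInverseʳ = λ { (inj₁ (a , x)) → refl ; (inj₂ (b , x)) → refl }
  ; commute = λ { (inj₁ (a , x)) → refl ; (inj₂ (b , x)) → refl } }

⊎-map₁-suc-Conjugate : ∀ {A : Set} {f : A → A} {r}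
  → Conjugate (Sum.map f (map₁ {C = Fin r} f)) (map₁ {C = Fin (suc r)} f)
⊎-map₁-suc-Conjugate = record
  { to = λ { (inj₁ a) → a , zero ; (inj₂ (a , p)) → a , suc p }
  ; from = λ { (a , zero) → inj₁ a ; (a , suc p) → inj₂ (a , p) }
  ; strictlyInverseˡ = λ { (a , zero) → refl ; (a , suc p) → refl }
  ; strictlyInverseʳ = λ { (inj₁ a) → refl ; (inj₂ (a , p)) → refl }
  ; commute = λ { (inj₁ a) → refl ; (inj₂ (a , p)) → refl } }

Conjugate-iter : ∀ {A B : Set} {f : A → A} {g : B → B} (c : Conjugate f g) j a
                 → Conjugate.to c (iter j f a) ≡ iter j g (Conjugate.to c a)
Conjugate-iter c zero    a = refl
Conjugate-iter {g = g} c (suc j) a = trans (Conjugate.commute c _) (cong g (Conjugate-iter c j a))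

iter-map₁ : ∀ {A R : Set} (f : A → A) j (a : A) (x : R) → iter j (map₁ f) (a , x) ≡ (iter j f a , x)
iter-map₁ f zero    a x = refl
iter-map₁ f (suc j) a x = cong (map₁ f) (iter-map₁ f j a x)

stdPerm-∷-Conjugate : ∀ a as → Conjugate (stdPerm (a ∷ as)) (Sum.map cyc (stdPerm as))
stdPerm-∷-Conjugate a as = record
  { to = splitAt a ; from = join a (sum as)
  ; strictlyInverseˡ = splitAt-join a (sum as) ; strictlyInverseʳ = join-splitAt a (sum as)
  ; commute = commute }
  where
  commute : ∀ x → splitAt a (stdPerm (a ∷ as) x) ≡ Sum.map cyc (stdPerm as) (splitAt a x)
  commute x with splitAt a x
  ... | inj₁ y = splitAt-join a (sum as) (inj₁ (cyc y))
  ... | inj₂ z = splitAt-join a (sum as) (inj₂ (stdPerm as z))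

stdPerm-++-Conjugate : ∀ xs ys → Conjugate (stdPerm (xs ++ ys)) (Sum.map (stdPerm xs) (stdPerm ys))
stdPerm-++-Conjugate []       ys = ⊎-identityˡ-Conjugate
stdPerm-++-Conjugate (x ∷ xs) ys =
  Conjugate-trans (stdPerm-∷-Conjugate x (xs ++ ys))
  (Conjugate-trans (Conjugate-⊎ Conjugate-refl (stdPerm-++-Conjugate xs ys))
  (Conjugate-trans ⊎-assoc-Conjugate
                   (Conjugate-⊎ (Conjugate-sym (stdPerm-∷-Conjugate x xs)) Conjugate-refl)))

stdPerm-replicate-Conjugate : ∀ a r → Conjugate (stdPerm (replicate r a)) (map₁ {C = Fin r} cyc)
stdPerm-replicate-Conjugate a zero = record
  { to = λ () ; from = λ { (_ , ()) }
  ; strictlyInverseˡ = λ { (_ , ()) } ; strictlyInverseʳ = λ () ; commute = λ () }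
stdPerm-replicate-Conjugate a (suc r) =
  Conjugate-trans (stdPerm-∷-Conjugate a (replicate r a))
  (Conjugate-trans (Conjugate-⊎ Conjugate-refl (stdPerm-replicate-Conjugate a r))
                   ⊎-map₁-suc-Conjugate)

stdPerm-^P-Conjugate : ∀ α r → Conjugate (stdPerm (α ^P r)) (map₁ {C = Fin r} (stdPerm α))
stdPerm-^P-Conjugate [] r = record
  { to = λ () ; from = λ { (() , _) }
  ; strictlyInverseˡ = λ { (() , _) } ; strictlyInverseʳ = λ () ; commute = λ () }
stdPerm-^P-Conjugate (a ∷ as) r =
  Conjugate-trans (stdPerm-++-Conjugate (replicate r a) (as ^P r))
  (Conjugate-trans (Conjugate-⊎ (stdPerm-replicate-Conjugate a r) (stdPerm-^P-Conjugate as r))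
  (Conjugate-trans ×-distribʳ-⊎-Conjugate
                   (Conjugate-map₁ (Conjugate-sym (stdPerm-∷-Conjugate a as)))))

pointwise⇒coset : ∀ {m} {ρ : Fin m → Fin m} {V : FinSet} {l μ : Fin m ↔ Carrier V}
  → (∀ x → Inverse.to l x ≡ Inverse.to μ x) → EqC.EqClosure (cosetRel m (cyclicSub ρ) V) l μ
pointwise⇒coset {m} e = EqC.return (idU (FinFS m) , (0 , λ _ → refl) , λ x → sym (e x))

module CyclicComposition {n N r : ℕ} (σ : Fin n → Fin n) (τ : Fin N → Fin N)
                         (φ : Conjugate τ (map₁ {C = Fin r} σ)) (r₀ : Fin r) where

  open Inverse
  module φ = Conjugate φ

  F : Species
  F = XnMod n (cyclicSub σ)

  G : Species
  G = Xpow r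

  CosetEq : (U : FinSet) → Fin N ↔ Carrier U → Fin N ↔ Carrier U → Set
  CosetEq U = EqC.EqClosure (cosetRel N (cyclicSub τ) U)

  syntax CosetEq U l μ = l ≈[ U ] μ

  lift : (Fin n ↔ Fin n) → (Fin N ↔ Fin N)
  lift h = mk↔ₛ′ (φ.from ∘ map₁ (to h) ∘ φ.to) (φ.from ∘ map₁ (from h) ∘ φ.to)
    (λ x → trans (cong (φ.from ∘ map₁ (to h)) (φ.strictlyInverseˡ _))
      (trans (cong (λ y → φ.from (y , _)) (strictlyInverseˡ h _)) (φ.strictlyInverseʳ x)))
    (λ x → trans (cong (φ.from ∘ map₁ (from h)) (φ.strictlyInverseˡ _))
      (trans (cong (λ y → φ.from (y , _)) (strictlyInverseʳ h _)) (φ.strictlyInverseʳ x)))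

  lift-iter : ∀ (h : Fin n ↔ Fin n) j → (∀ i → to h i ≡ iter j σ i) → ∀ x → to (lift h) x ≡ iter j τ x
  lift-iter h j hj x = begin
    φ.from (to h i , p)               ≡⟨ cong (λ y → φ.from (y , p)) (hj i) ⟩
    φ.from (iter j σ i , p)           ≡⟨ cong φ.from (sym (iter-map₁ σ j i p)) ⟩
    φ.from (iter j (map₁ σ) (φ.to x)) ≡⟨ cong φ.from (sym (Conjugate-iter φ j x)) ⟩
    φ.from (φ.to (iter j τ x))        ≡⟨ φ.strictlyInverseʳ _ ⟩
    iter j τ x                        ∎
    where open ≡-Reasoning; i = proj₁ (φ.to x); p = proj₂ (φ.to x)

  module _ {U : FinSet} (s : CompStr F G U) where
    open CompStr s

    gstr-cong : ∀ {i j} → i ≡ j → ∀ p → proj₁ (to (gstr i) p) ≡ proj₁ (to (gstr j) p)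
    gstr-cong refl p = refl

    gstr⁻¹-cong : ∀ {i j} (e : i ≡ j) u (e₁ : blk u ≡ i) (e₂ : blk u ≡ j)
                  → from (gstr i) (u , e₁) ≡ from (gstr j) (u , e₂)
    gstr⁻¹-cong refl u e₁ e₂ = cong (λ q → from (gstr _) (u , q)) (Fin-irr e₁ e₂)

    point : (Fin n ↔ Fin k) → Fin n × Fin r → Carrier U
    point ψ (i , p) = proj₁ (to (gstr (to ψ i)) p)

    listing : (Fin n ↔ Fin k) → Fin N ↔ Carrier U
    listing ψ = mk↔ₛ′ (point ψ ∘ φ.to) (φ.from ∘ unpoint) to∘from from∘to
      where
      unpoint : Carrier U → Fin n × Fin r
      unpoint u = from ψ (blk u) , from (gstr (blk u)) (u , refl)

      to∘from : ∀ u → point ψ (φ.to (φ.from (unpoint u))) ≡ u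
      to∘from u = trans (cong (point ψ) (φ.strictlyInverseˡ _))
        (trans (gstr-cong (strictlyInverseˡ ψ (blk u)) _)
               (cong proj₁ (strictlyInverseˡ (gstr (blk u)) (u , refl))))

      unpoint-point : ∀ i p → unpoint (point ψ (i , p)) ≡ (i , p)
      unpoint-point i p = cong₂ _,_ (trans (cong (from ψ) e) (strictlyInverseʳ ψ i))
          (trans (gstr⁻¹-cong e _ refl e) (strictlyInverseʳ (gstr (to ψ i)) p))
        where e = proj₂ (to (gstr (to ψ i)) p)

      from∘to : ∀ x → φ.from (unpoint (point ψ (φ.to x))) ≡ x
      from∘to x = trans (cong φ.from (unpoint-point _ _)) (φ.strictlyInverseʳ x)

    listing-resp-coset : ∀ {ψ ψ′} → cosetRel n (cyclicSub σ) (FinFS k) ψ ψ′ → listing ψ ≈[ U ] listing ψ′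
    listing-resp-coset {ψ} {ψ′} (h , (j , hj) , ψ′≡ψh) =
      EqC.return (lift h , (j , lift-iter h j hj) , λ x →
        trans (gstr-cong (ψ′≡ψh (proj₁ (φ.to x))) (proj₂ (φ.to x)))
              (cong (point ψ) (sym (φ.strictlyInverseˡ _))))

    listing-resp-≈ : ∀ {ψ ψ′} → EqC.EqClosure (cosetRel n (cyclicSub σ) (FinFS k)) ψ ψ′
                     → listing ψ ≈[ U ] listing ψ′
    listing-resp-≈ = EqC.gfold (EqC.isEquivalence _) listing (λ {ψ} {ψ′} → listing-resp-coset {ψ} {ψ′})

  toCoset : {U : FinSet} → CompStr F G U → Fin N ↔ Carrier U
  toCoset s = listing s (CompStr.fstr s)

  toCoset-resp-relabel : ∀ {U} {s t : CompStr F G U} → relabel F G U s t → toCoset s ≈[ U ] toCoset t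
  toCoset-resp-relabel {U} {s} {t} (π , _ , fstr≈ , gstr≈) =
    EqC.transitive (cosetRel N (cyclicSub τ) U)
      (pointwise⇒coset {ρ = τ} {V = U} {l = toCoset s} {μ = listing t ψ} λ x → cong proj₁ (gstr≈ _ _))
      (listing-resp-≈ t {ψ} fstr≈)
    where ψ = π ↔-∘ CompStr.fstr s

  module _ (h : Fin N ↔ Fin N) (j : ℕ) (hj : ∀ x → to h x ≡ iter j τ x) where

    power-on-points : ∀ i p → to h (φ.from (i , p)) ≡ φ.from (iter j σ i , p)
    power-on-points i p = begin
      to h (φ.from (i , p))
        ≡⟨ hj _ ⟩
      iter j τ (φ.from (i , p))
        ≡⟨ sym (φ.strictlyInverseʳ _) ⟩
      φ.from (φ.to (iter j τ (φ.from (i , p))))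
        ≡⟨ cong φ.from (Conjugate-iter φ j _) ⟩
      φ.from (iter j (map₁ σ) (φ.to (φ.from (i , p))))
        ≡⟨ cong (φ.from ∘ iter j (map₁ σ)) (φ.strictlyInverseˡ _) ⟩
      φ.from (iter j (map₁ σ) (i , p))
        ≡⟨ cong φ.from (iter-map₁ σ j i p) ⟩
      φ.from (iter j σ i , p)
        ∎
      where open ≡-Reasoning

    -- σ^j is invertible because h = τ^j is; the inverse is read off on the copy r₀ of [n].
    power↔ : Fin n ↔ Fin n
    power↔ = mk↔ₛ′ (iter j σ) unpower to∘from from∘to
      where
      unpower : Fin n → Fin n
      unpower i = proj₁ (φ.to (from h (φ.from (i , r₀))))

      to∘from : ∀ i → iter j σ (unpower i) ≡ i
      to∘from i = cong proj₁ (begin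
        (iter j σ (proj₁ z) , proj₂ z)
          ≡⟨ sym (φ.strictlyInverseˡ _) ⟩
        φ.to (φ.from (iter j σ (proj₁ z) , proj₂ z))
          ≡⟨ cong φ.to (sym (power-on-points (proj₁ z) (proj₂ z))) ⟩
        φ.to (to h (φ.from z))
          ≡⟨ cong (φ.to ∘ to h) (φ.strictlyInverseʳ _) ⟩
        φ.to (to h (from h (φ.from (i , r₀))))
          ≡⟨ cong φ.to (strictlyInverseˡ h _) ⟩
        φ.to (φ.from (i , r₀))
          ≡⟨ φ.strictlyInverseˡ _ ⟩
        (i , r₀)
          ∎)
        where open ≡-Reasoning; z = φ.to (from h (φ.from (i , r₀)))

      from∘to : ∀ i → unpower (iter j σ i) ≡ i
      from∘to i = trans (cong (proj₁ ∘ φ.to ∘ from h) (sym (power-on-points i r₀)))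
        (trans (cong (proj₁ ∘ φ.to) (strictlyInverseʳ h _)) (cong proj₁ (φ.strictlyInverseˡ (i , r₀))))

  module _ (U : FinSet) (μ : Fin N ↔ Carrier U) where

    label : Carrier U → Fin n
    label u = proj₁ (φ.to (from μ u))

    label-point : ∀ i p → label (to μ (φ.from (i , p))) ≡ i
    label-point i p = trans (cong (proj₁ ∘ φ.to) (strictlyInverseʳ μ _)) (cong proj₁ (φ.strictlyInverseˡ (i , p)))

    block : (i : Fin n) → Fin r ↔ Fib U label i
    block i = mk↔ₛ′ (λ p → to μ (φ.from (i , p)) , label-point i p) (λ v → proj₂ (φ.to (from μ (proj₁ v))))
      (λ { (u , refl) → Σ-ext (trans (cong (to μ) (φ.strictlyInverseʳ (from μ u))) (strictlyInverseˡ μ u)) })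
      (λ p → trans (cong (proj₂ ∘ φ.to) (strictlyInverseʳ μ _)) (cong proj₂ (φ.strictlyInverseˡ (i , p))))

    decompose : CompStr F G U
    decompose = record
      { k = n ; blk = label ; nonempty = λ i → to μ (φ.from (i , r₀)) , label-point i r₀
      ; gstr = block ; fstr = idU (FinFS n) }

  decompose-resp-coset : ∀ {U} {μ μ′ : Fin N ↔ Carrier U} → cosetRel N (cyclicSub τ) U μ μ′
                         → relabel F G U (decompose U μ′) (decompose U μ)
  decompose-resp-coset {U} {μ} {μ′} (h , (j , hj) , μ′≡μh) =
    power↔ h j hj , label≡ , EqC.symmetric _ (EqC.return (power↔ h j hj , (j , λ _ → refl) , λ _ → refl)) ,
    λ i p → Σ-ext (trans (μ′≡μh _) (cong (to μ) (power-on-points h j hj i p)))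
    where
    label≡ : ∀ u → label U μ u ≡ iter j σ (label U μ′ u)
    label≡ u = begin
      proj₁ (φ.to (from μ u))
        ≡⟨ cong (proj₁ ∘ φ.to ∘ from μ) (trans (sym (strictlyInverseˡ μ′ u)) (μ′≡μh v)) ⟩
      proj₁ (φ.to (from μ (to μ (to h v))))
        ≡⟨ cong (proj₁ ∘ φ.to) (trans (strictlyInverseʳ μ _) (hj v)) ⟩
      proj₁ (φ.to (iter j τ v))
        ≡⟨ cong proj₁ (Conjugate-iter φ j v) ⟩
      proj₁ (iter j (map₁ σ) (φ.to v))
        ≡⟨ cong proj₁ (iter-map₁ σ j _ (proj₂ (φ.to v))) ⟩
      iter j σ (proj₁ (φ.to v))
        ∎
      where open ≡-Reasoning; v = from μ′ u

  decompose-toCoset : ∀ {U} (s : CompStr F G U) → relabel F G U (decompose U (toCoset s)) s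
  decompose-toCoset {U} s =
    fstr , label≡ , pointwise⇒coset {ρ = σ} {V = FinFS k} {l = fstr ↔-∘ idU (FinFS n)} {μ = fstr} (λ _ → refl) ,
    λ i p → Σ-ext (cong (point s fstr) (φ.strictlyInverseˡ (i , p)))
    where
    open CompStr s
    label≡ : ∀ u → blk u ≡ to fstr (label U (toCoset s) u)
    label≡ u = trans (sym (strictlyInverseˡ fstr (blk u))) (cong (to fstr ∘ proj₁) (sym (φ.strictlyInverseˡ _)))

  iso : (U : FinSet) → Inverse (Str (F ∘S G) U) (Str (XnMod N (cyclicSub τ)) U)
  iso U = record
    { to = toCoset
    ; from = decompose U
    ; to-cong = to-cong′
    ; from-cong = from-cong′
    ; inverse = (λ {μ} e → EqC.transitive _ (to-cong′ e)
                   (pointwise⇒coset {ρ = τ} {V = U} {l = toCoset (decompose U μ)} {μ = μ}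
                     λ x → cong (to μ) (φ.strictlyInverseʳ x)))
              , (λ {s} e → EqC.transitive _ (from-cong′ e) (EqC.return (decompose-toCoset s))) }
    where
    to-cong′ : ∀ {s t} → EqC.EqClosure (relabel F G U) s t → toCoset s ≈[ U ] toCoset t
    to-cong′ = EqC.gfold (EqC.isEquivalence _) toCoset (λ {s} {t} → toCoset-resp-relabel {U} {s} {t})

    from-cong′ : ∀ {μ μ′} → μ ≈[ U ] μ′ → EqC.EqClosure (relabel F G U) (decompose U μ) (decompose U μ′)
    from-cong′ e = EqC.join (EqC.gmap (decompose U)
      (λ {μ} {μ′} c → EqC.symmetric _ (EqC.return (decompose-resp-coset {U} {μ} {μ′} c))) e)

  composition≅ : (F ∘S G) ≅ XnMod N (cyclicSub τ)
  composition≅ = record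
    { iso = iso
    ; natural = λ {V = V} f s → pointwise⇒coset {ρ = τ} {V = V}
                  {l = toCoset (compMap F G f s)} {μ = f ↔-∘ toCoset s} (λ _ → refl) }

mainTheorem2 : (α : List ℕ) → IsPartition α → (r : ℕ) → 1 ≤ r →
               (C α ∘S Xpow r) ≅ C (α ^P r)
mainTheorem2 α _ (suc r) _ =
  CyclicComposition.composition≅ (stdPerm α) (stdPerm (α ^P suc r)) (stdPerm-^P-Conjugate α (suc r)) zero
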